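{- For all integers $m\ge0$ and $n\ge0$, \[\mathcal{C}_{n+m+1,m+1}=\sum_{\substack{a+b+c=n\\ a,b,c\ge0}}\mathcal{C}_{a+m,m}\,\mathcal{C}_{b,0}\,\mathcal{C}_{c,0}.\]
   Context: A path is a finite sequence of points of $\mathbb{Z}^2$ in which each step is $(1,0)$ or $(0,1)$. For integers $0\le m\le n$, $\mathcal{C}_{n,m}$ denotes the number of paths from $(0,-2m)$ to $(n-m,n-m)$ not crossing the line $y=x$, i.e. all of whose points $(p,q)$ satisfy $q\le p$. -}

module Defs where

open import Data.Nat using (ℕ; zero; suc; _+_; _*_; _∸_)
open import Data.Integer as ℤ using (ℤ; +_; _≤ᵇ_)
open import Data.Bool using (Bool; true; false; _∧_)
open import Data.List using (List; []; _∷_; map; _++_; length; filter; upTo)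
open import Data.Nat.ListAction using (sum)
open import Data.Product using (_×_; _,_)
open import Relation.Nullary.Decidable using (Dec; yes; no)
open import Relation.Binary.PropositionalEquality using (_≡_)
open import Relation.Nullary using (Dec)
open import Data.Bool using (T)
open import Relation.Nullary.Decidable using (T?)

data Step : Set where
  right up : Step

Point : Set
Point = ℤ × ℤ

move : Point → Step → Point
move (p , q) right = (p ℤ.+ + 1 , q)
move (p , q) up    = (p , q ℤ.+ + 1)

stepSeqs : ℕ → List (List Step)
stepSeqs zero    = [] ∷ []
stepSeqs (suc k) = map (right ∷_) (stepSeqs k) ++ map (up ∷_) (stepSeqs k)

points : Point → List Step → List Point
points s []       = s ∷ []
points s (d ∷ ds) = s ∷ points (move s d) ds

endpoint : Point → List Step → Point
endpoint s []       = s
endpoint s (d ∷ ds) = endpoint (move s d) ds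

belowDiag : Point → Bool
belowDiag (p , q) = q ≤ᵇ p

allB : List Point → Bool
allB []       = true
allB (x ∷ xs) = belowDiag x ∧ allB xs

eqℤ : ℤ → ℤ → Bool
eqℤ a b = (a ≤ᵇ b) ∧ (b ≤ᵇ a)

samePoint : Point → Point → Bool
samePoint (a , b) (c , d) = eqℤ a c ∧ eqℤ b d

goodPath : Point → Point → List Step → Bool
goodPath s t ds = samePoint (endpoint s ds) t ∧ allB (points s ds)

countPaths : ℕ → Point → Point → ℕ
countPaths k s t = length (filter (λ ds → T? (goodPath s t ds)) (stepSeqs k))

-- 𝒞_{n,m}: paths from (0,-2m) to (n-m,n-m) not crossing y = x.
-- Any path between these points has exactly (n-m)+(n+m) = 2n steps.
𝒞 : ℕ → ℕ → ℕ
𝒞 n m = countPaths (2 * n) (+ 0 , ℤ.- (+ (2 * m))) ((+ n ℤ.- + m) , (+ n ℤ.- + m))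

sumTriples : ℕ → (ℕ → ℕ → ℕ → ℕ) → ℕ
sumTriples n f = sum (map (λ a → sum (map (λ b → f a b (n ∸ a ∸ b)) (upTo (suc (n ∸ a))))) (upTo (suc n)))

{-# OPTIONS --safe #-}
module Submission where

-- Measure a lattice point by its height p − q above the diagonal.  A path counted by 𝒞 n m is
-- then a walk of 2n steps ±1 from height 2m down to 0 that never becomes negative.  Cutting a
-- walk from height h + 1 at its first visit to h leaves an excursion at heights ≥ h + 1, one
-- down-step and a walk from h; so the walks from h + 2 are the Cauchy product of two shifted
-- excursion sequences with the walks from h.  Between even heights all walks have even length,
-- and a walk from 2m needs at least 2m steps; halving the lengths and dropping these first m
-- empty terms turns the product into Σ_a 𝒞 (a + m) m · (C ⋆ C) (n − a) with C b = 𝒞 b 0.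

open import Defs

module Convolution where
  open import Data.List using (List; []; _∷_; upTo; applyUpTo; map)
  open import Data.List.Properties using (map-cong; map-∘; map-upTo)
  open import Data.Nat using (ℕ; zero; suc; _+_; _*_; _∸_; _≤_; _<_; z≤n; s≤s)
  open import Data.Nat.ListAction using (sum)
  open import Data.Nat.Properties
  open import Function using (_∘_)
  open import Relation.Binary.PropositionalEquality
  open ≡-Reasoning
  open import Algebra.Properties.CommutativeSemigroup +-commutativeSemigroup using (interchange)

  infixl 7 _⋆_

  _⋆_ : (ℕ → ℕ) → (ℕ → ℕ) → ℕ → ℕ
  (f ⋆ g) zero    = f 0 * g 0
  (f ⋆ g) (suc k) = f 0 * g (suc k) + (f ∘ suc ⋆ g) k

  ⋆-cong-≤ : ∀ {f f′ g g′} k → (∀ {i} → i ≤ k → f i ≡ f′ i) → (∀ {i} → i ≤ k → g i ≡ g′ i) →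
             (f ⋆ g) k ≡ (f′ ⋆ g′) k
  ⋆-cong-≤ zero    f≡f′ g≡g′ = cong₂ _*_ (f≡f′ z≤n) (g≡g′ z≤n)
  ⋆-cong-≤ (suc k) f≡f′ g≡g′ = cong₂ _+_ (cong₂ _*_ (f≡f′ z≤n) (g≡g′ ≤-refl))
    (⋆-cong-≤ k (λ i≤k → f≡f′ (s≤s i≤k)) (λ i≤k → g≡g′ (m≤n⇒m≤1+n i≤k)))

  ⋆-cong : ∀ {f f′ g g′} → f ≗ f′ → g ≗ g′ → f ⋆ g ≗ f′ ⋆ g′
  ⋆-cong f≗f′ g≗g′ k = ⋆-cong-≤ k (λ {i} _ → f≗f′ i) (λ {i} _ → g≗g′ i)

  ⋆-distribʳ-+ : ∀ f g h → (λ i → f i + g i) ⋆ h ≗ λ k → (f ⋆ h) k + (g ⋆ h) k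
  ⋆-distribʳ-+ f g h zero    = *-distribʳ-+ (h 0) (f 0) (g 0)
  ⋆-distribʳ-+ f g h (suc k) = begin
    (f 0 + g 0) * h (suc k) + ((λ i → f (suc i) + g (suc i)) ⋆ h) k
      ≡⟨ cong₂ _+_ (*-distribʳ-+ (h (suc k)) (f 0) (g 0)) (⋆-distribʳ-+ (f ∘ suc) (g ∘ suc) h k) ⟩
    (f 0 * h (suc k) + g 0 * h (suc k)) + ((f ∘ suc ⋆ h) k + (g ∘ suc ⋆ h) k)
      ≡⟨ interchange (f 0 * h (suc k)) _ _ _ ⟩
    (f 0 * h (suc k) + (f ∘ suc ⋆ h) k) + (g 0 * h (suc k) + (g ∘ suc ⋆ h) k) ∎

  ⋆-scaleˡ : ∀ c f g → (λ i → c * f i) ⋆ g ≗ λ k → c * (f ⋆ g) k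
  ⋆-scaleˡ c f g zero    = *-assoc c (f 0) (g 0)
  ⋆-scaleˡ c f g (suc k) = begin
    c * f 0 * g (suc k) + ((λ i → c * f (suc i)) ⋆ g) k
      ≡⟨ cong₂ _+_ (*-assoc c (f 0) (g (suc k))) (⋆-scaleˡ c (f ∘ suc) g k) ⟩
    c * (f 0 * g (suc k)) + c * (f ∘ suc ⋆ g) k
      ≡⟨ *-distribˡ-+ c (f 0 * g (suc k)) _ ⟨
    c * (f 0 * g (suc k) + (f ∘ suc ⋆ g) k) ∎

  ⋆-assoc : ∀ f g h → f ⋆ (g ⋆ h) ≗ f ⋆ g ⋆ h
  ⋆-assoc f g h zero    = sym (*-assoc (f 0) (g 0) (h 0))
  ⋆-assoc f g h (suc k) = begin
    f 0 * (g 0 * h (suc k) + (g ∘ suc ⋆ h) k) + (f ∘ suc ⋆ (g ⋆ h)) k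
      ≡⟨ cong₂ _+_ (*-distribˡ-+ (f 0) (g 0 * h (suc k)) _) (⋆-assoc (f ∘ suc) g h k) ⟩
    (f 0 * (g 0 * h (suc k)) + f 0 * (g ∘ suc ⋆ h) k) + (f ∘ suc ⋆ g ⋆ h) k
      ≡⟨ +-assoc (f 0 * (g 0 * h (suc k))) _ _ ⟩
    f 0 * (g 0 * h (suc k)) + (f 0 * (g ∘ suc ⋆ h) k + (f ∘ suc ⋆ g ⋆ h) k)
      ≡⟨ cong₂ _+_ (*-assoc (f 0) (g 0) (h (suc k)))
                   (trans (⋆-distribʳ-+ _ (f ∘ suc ⋆ g) h k)
                          (cong (_+ (f ∘ suc ⋆ g ⋆ h) k) (⋆-scaleˡ (f 0) (g ∘ suc) h k))) ⟨
    f 0 * g 0 * h (suc k) + ((λ i → f 0 * g (suc i) + (f ∘ suc ⋆ g) i) ⋆ h) k ∎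

  ⋆-sucʳ : ∀ f g k → (f ⋆ g) (suc k) ≡ (f ⋆ g ∘ suc) k + f (suc k) * g 0
  ⋆-sucʳ f g zero    = refl
  ⋆-sucʳ f g (suc k) = begin
    f 0 * g (suc (suc k)) + (f ∘ suc ⋆ g) (suc k)
      ≡⟨ cong (f 0 * g (suc (suc k)) +_) (⋆-sucʳ (f ∘ suc) g k) ⟩
    f 0 * g (suc (suc k)) + ((f ∘ suc ⋆ g ∘ suc) k + f (suc (suc k)) * g 0)
      ≡⟨ +-assoc (f 0 * g (suc (suc k))) _ _ ⟨
    (f ⋆ g ∘ suc) (suc k) + f (suc (suc k)) * g 0 ∎

  ⋆-comm : ∀ f g → f ⋆ g ≗ g ⋆ f
  ⋆-comm f g zero    = *-comm (f 0) (g 0)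
  ⋆-comm f g (suc k) = begin
    f 0 * g (suc k) + (f ∘ suc ⋆ g) k  ≡⟨ cong (f 0 * g (suc k) +_) (⋆-comm (f ∘ suc) g k) ⟩
    f 0 * g (suc k) + (g ⋆ f ∘ suc) k  ≡⟨ +-comm (f 0 * g (suc k)) _ ⟩
    (g ⋆ f ∘ suc) k + f 0 * g (suc k)  ≡⟨ cong ((g ⋆ f ∘ suc) k +_) (*-comm (f 0) (g (suc k))) ⟩
    (g ⋆ f ∘ suc) k + g (suc k) * f 0  ≡⟨ ⋆-sucʳ g f k ⟨
    (g ⋆ f) (suc k)                    ∎

  ⋆-shiftʳ : ∀ f g k → g 0 ≡ 0 → (f ⋆ g) (suc k) ≡ (f ⋆ g ∘ suc) k
  ⋆-shiftʳ f g k g0≡0 rewrite ⋆-sucʳ f g k | g0≡0 | *-zeroʳ (f (suc k)) = +-identityʳ _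

  ⋆-shiftʳ-+ : ∀ f g m k → (∀ {i} → i < m → g i ≡ 0) → (f ⋆ g) (m + k) ≡ (f ⋆ (λ i → g (m + i))) k
  ⋆-shiftʳ-+ f g zero    k _        = refl
  ⋆-shiftʳ-+ f g (suc m) k g<m≡0 =
    trans (⋆-shiftʳ f g (m + k) (g<m≡0 (s≤s z≤n))) (⋆-shiftʳ-+ f (g ∘ suc) m k (λ i<m → g<m≡0 (s≤s i<m)))

  double : ℕ → ℕ
  double zero    = zero
  double (suc n) = suc (suc (double n))

  double-mono-< : ∀ {m n} → m < n → double m < double n
  double-mono-< {zero}  {suc n} _         = s≤s z≤n
  double-mono-< {suc m} {suc n} (s≤s m<n) = s≤s (s≤s (double-mono-< m<n))

  2*≡double : ∀ n → 2 * n ≡ double n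
  2*≡double zero    = refl
  2*≡double (suc n) = cong suc (trans (+-suc n (n + 0)) (cong suc (2*≡double n)))

  ⋆-halve : ∀ f g → (∀ i → g (suc (double i)) ≡ 0) → ∀ k → (f ⋆ g) (double k) ≡ (f ∘ double ⋆ g ∘ double) k
  ⋆-halve f g g-odd≡0 zero    = refl
  ⋆-halve f g g-odd≡0 (suc k) rewrite g-odd≡0 k | *-zeroʳ (f 1) =
    cong (f 0 * g (double (suc k)) +_) (⋆-halve (f ∘ suc ∘ suc) g g-odd≡0 k)

  *-distribˡ-sum : ∀ c ns → c * sum ns ≡ sum (map (c *_) ns)
  *-distribˡ-sum c []       = *-zeroʳ c
  *-distribˡ-sum c (n ∷ ns) = trans (*-distribˡ-+ c n (sum ns)) (cong (c * n +_) (*-distribˡ-sum c ns))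

  ⋆-as-sum : ∀ f g k → (f ⋆ g) k ≡ sum (map (λ i → f i * g (k ∸ i)) (upTo (suc k)))
  ⋆-as-sum f g k = trans (⋆-as-applyUpTo f k) (cong sum (sym (map-upTo _ (suc k))))
    where
    ⋆-as-applyUpTo : ∀ f k → (f ⋆ g) k ≡ sum (applyUpTo (λ i → f i * g (k ∸ i)) (suc k))
    ⋆-as-applyUpTo f zero    = sym (+-identityʳ (f 0 * g 0))
    ⋆-as-applyUpTo f (suc k) = cong (f 0 * g (suc k) +_) (⋆-as-applyUpTo (f ∘ suc) k)

  sumTriples-⋆ : ∀ n f g h → sumTriples n (λ a b c → f a * g b * h c) ≡ (f ⋆ (g ⋆ h)) n
  sumTriples-⋆ n f g h = begin
    sumTriples n (λ a b c → f a * g b * h c)              ≡⟨ cong sum (map-cong inner (upTo (suc n))) ⟩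
    sum (map (λ a → f a * (g ⋆ h) (n ∸ a)) (upTo (suc n))) ≡⟨ ⋆-as-sum f (g ⋆ h) n ⟨
    (f ⋆ (g ⋆ h)) n                                        ∎
    where
    inner : ∀ a → sum (map (λ b → f a * g b * h (n ∸ a ∸ b)) (upTo (suc (n ∸ a)))) ≡ f a * (g ⋆ h) (n ∸ a)
    inner a = begin
      sum (map (λ b → f a * g b * h (n ∸ a ∸ b)) bs)
        ≡⟨ cong sum (trans (map-cong (λ b → *-assoc (f a) (g b) _) bs) (map-∘ bs)) ⟩
      sum (map (f a *_) (map (λ b → g b * h (n ∸ a ∸ b)) bs))
        ≡⟨ *-distribˡ-sum (f a) (map (λ b → g b * h (n ∸ a ∸ b)) bs) ⟨
      f a * sum (map (λ b → g b * h (n ∸ a ∸ b)) bs)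
        ≡⟨ cong (f a *_) (⋆-as-sum g h (n ∸ a)) ⟨
      f a * (g ⋆ h) (n ∸ a) ∎
      where
      bs : List ℕ
      bs = upTo (suc (n ∸ a))

module Walks where
  open import Data.Nat using (ℕ; zero; suc; _+_; _<_; s≤s)
  open import Data.Nat.Induction using (<-rec)
  open import Data.Nat.Properties using (≤-refl; m<n⇒m<1+n; *-identityˡ; +-comm)
  open import Function using (_∘_)
  open import Relation.Binary.PropositionalEquality
  open ≡-Reasoning

  open Convolution

  -- walks h k counts the k-step walks with steps ±1 from height h to 0 that never go below 0.
  walks : ℕ → ℕ → ℕ
  walks zero    zero    = 1
  walks (suc h) zero    = 0
  walks zero    (suc k) = walks 1 k
  walks (suc h) (suc k) = walks (suc (suc h)) k + walks h k

  dyck : ℕ → ℕ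
  dyck = walks 0

  walks-< : ∀ {h k} → k < h → walks h k ≡ 0
  walks-< {suc h} {zero}  _         = refl
  walks-< {suc h} {suc k} (s≤s k<h) = cong₂ _+_ (walks-< (m<n⇒m<1+n (m<n⇒m<1+n k<h))) (walks-< k<h)

  mutual
    walks-even-odd : ∀ h k → walks (double h) (suc (double k)) ≡ 0
    walks-even-odd zero    k = walks-odd-even 0 k
    walks-even-odd (suc h) k = cong₂ _+_ (walks-odd-even (suc h) k) (walks-odd-even h k)

    walks-odd-even : ∀ h k → walks (suc (double h)) (double k) ≡ 0
    walks-odd-even h zero    = refl
    walks-odd-even h (suc k) = cong₂ _+_ (walks-even-odd (suc h) k) (walks-even-odd h k)

  FirstPassage : ℕ → Set
  FirstPassage j = ∀ h → walks (suc h) (suc j) ≡ (dyck ⋆ walks h) j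

  dyck⋆walks-suc : ∀ h i → (∀ {i′} → i′ < i → FirstPassage i′) →
                   (dyck ⋆ walks (suc h)) i ≡ (dyck ∘ suc ⋆ walks h) i
  dyck⋆walks-suc h zero    _       = refl
  dyck⋆walks-suc h (suc i) earlier = begin
    (dyck ⋆ walks (suc h)) (suc i)  ≡⟨ ⋆-shiftʳ dyck (walks (suc h)) i refl ⟩
    (dyck ⋆ walks (suc h) ∘ suc) i  ≡⟨ ⋆-cong-≤ i (λ _ → refl) (λ i′≤i → earlier (s≤s i′≤i) h) ⟩
    (dyck ⋆ (dyck ⋆ walks h)) i     ≡⟨ ⋆-assoc dyck dyck (walks h) i ⟩
    (dyck ⋆ dyck ⋆ walks h) i       ≡⟨ ⋆-cong-≤ i (λ i′≤i → earlier (s≤s i′≤i) 0) (λ _ → refl) ⟨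
    (dyck ∘ suc ∘ suc ⋆ walks h) i  ∎

  walks-first-passage : ∀ j → FirstPassage j
  walks-first-passage = <-rec FirstPassage passage
    where
    passage : ∀ j → (∀ {i} → i < j → FirstPassage i) → FirstPassage j
    passage zero    _       h = sym (*-identityˡ (walks h 0))
    passage (suc j) earlier h = begin
      walks (suc (suc h)) (suc j) + walks h (suc j)
        ≡⟨ cong (_+ walks h (suc j)) (earlier ≤-refl (suc h)) ⟩
      (dyck ⋆ walks (suc h)) j + walks h (suc j)
        ≡⟨ cong (_+ walks h (suc j)) (dyck⋆walks-suc h j (λ i<j → earlier (m<n⇒m<1+n i<j))) ⟩
      (dyck ∘ suc ⋆ walks h) j + walks h (suc j)
        ≡⟨ +-comm _ (walks h (suc j)) ⟩
      walks h (suc j) + (dyck ∘ suc ⋆ walks h) j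
        ≡⟨ cong (_+ (dyck ∘ suc ⋆ walks h) j) (*-identityˡ (walks h (suc j))) ⟨
      (dyck ⋆ walks h) (suc j) ∎

  walks-+2 : ∀ h k → walks (2 + h) (2 + k) ≡ (dyck ⋆ dyck ⋆ walks h) k
  walks-+2 h k = begin
    walks (2 + h) (2 + k)               ≡⟨ walks-first-passage (suc k) (suc h) ⟩
    (dyck ⋆ walks (suc h)) (suc k)      ≡⟨ ⋆-shiftʳ dyck (walks (suc h)) k refl ⟩
    (dyck ⋆ walks (suc h) ∘ suc) k      ≡⟨ ⋆-cong (λ _ → refl) (λ i → walks-first-passage i h) k ⟩
    (dyck ⋆ (dyck ⋆ walks h)) k         ≡⟨ ⋆-assoc dyck dyck (walks h) k ⟩
    (dyck ⋆ dyck ⋆ walks h) k           ∎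

  walks-decomposition : ∀ m n → walks (2 + double m) (2 + double (m + n)) ≡
    ((λ a → walks (double m) (double (m + a))) ⋆ (dyck ∘ double ⋆ dyck ∘ double)) n
  walks-decomposition m n = begin
    walks (2 + double m) (2 + double (m + n))
      ≡⟨ walks-+2 (double m) (double (m + n)) ⟩
    (dyck ⋆ dyck ⋆ walks (double m)) (double (m + n))
      ≡⟨ ⋆-halve (dyck ⋆ dyck) (walks (double m)) (walks-even-odd m) (m + n) ⟩
    ((dyck ⋆ dyck) ∘ double ⋆ walks (double m) ∘ double) (m + n)
      ≡⟨ ⋆-cong (⋆-halve dyck dyck (walks-even-odd 0)) (λ _ → refl) (m + n) ⟩
    (dyck ∘ double ⋆ dyck ∘ double ⋆ walks (double m) ∘ double) (m + n)
      ≡⟨ ⋆-shiftʳ-+ _ (walks (double m) ∘ double) m n (λ i<m → walks-< (double-mono-< i<m)) ⟩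
    (dyck ∘ double ⋆ dyck ∘ double ⋆ (λ a → walks (double m) (double (m + a)))) n
      ≡⟨ ⋆-comm _ _ n ⟩
    ((λ a → walks (double m) (double (m + a))) ⋆ (dyck ∘ double ⋆ dyck ∘ double)) n ∎

module LatticePaths where
  open import Algebra.Bundles using (CommutativeMonoid)
  open import Data.Bool using (Bool; true; false; T; _∧_)
  open import Data.Bool.Properties using (T-≡; T-∧; ∧-commutativeMonoid; ∧-zeroʳ; ¬-not)
  open import Data.Empty using (⊥-elim)
  open import Data.Integer using (ℤ; +_; _+_; _-_; -_; _*_; _≤ᵇ_)
  import Data.Integer.Properties as ℤ
  open import Data.Integer.Tactic.RingSolver using (solve-∀)
  open import Data.List using (List; []; _∷_; map; _++_; length; filterᵇ)
  open import Data.List.Properties using (filter-++; length-++)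
  open import Data.Nat as ℕ using (ℕ; zero; suc)
  import Data.Nat.Properties as ℕ
  open import Data.Product using (_,_; proj₁)
  open import Function using (_∘_; Equivalence)
  open import Relation.Binary.PropositionalEquality
  open import Relation.Nullary.Decidable using (T?)

  open import Algebra.Properties.CommutativeSemigroup (CommutativeMonoid.commutativeSemigroup ∧-commutativeMonoid)
    using (x∙yz≈y∙xz)
  open import Algebra.Properties.AbelianGroup ℤ.+-0-abelianGroup using (∙-cancelˡ)
  open Equivalence using (to; from)

  open Convolution using (double; 2*≡double)
  open Walks using (walks)

  count : {A : Set} → (A → Bool) → List A → ℕ
  count p xs = length (filterᵇ p xs)

  count-++ : ∀ {A : Set} (p : A → Bool) xs ys → count p (xs ++ ys) ≡ count p xs ℕ.+ count p ys
  count-++ p xs ys = trans (cong length (filter-++ (T? ∘ p) xs ys)) (length-++ (filterᵇ p xs))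

  count-map : ∀ {A B : Set} (p : B → Bool) (q : A → Bool) (f : A → B) → (∀ x → p (f x) ≡ q x) →
              ∀ xs → count p (map f xs) ≡ count q xs
  count-map p q f pf≡q []       = refl
  count-map p q f pf≡q (x ∷ xs) rewrite pf≡q x with q x
  ... | true  = cong suc (count-map p q f pf≡q xs)
  ... | false = count-map p q f pf≡q xs

  count-none : ∀ {A : Set} (p : A → Bool) → (∀ x → p x ≡ false) → ∀ xs → count p xs ≡ 0
  count-none p p≡false []       = refl
  count-none p p≡false (x ∷ xs) rewrite p≡false x = count-none p p≡false xs

  goodPath-∷ : ∀ s t d ds → goodPath s t (d ∷ ds) ≡ belowDiag s ∧ goodPath (move s d) t ds
  goodPath-∷ s t d ds = x∙yz≈y∙xz (samePoint (endpoint (move s d) ds) t) (belowDiag s) (allB (points (move s d) ds))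

  countPaths-suc : ∀ k s t → belowDiag s ≡ true →
                   countPaths (suc k) s t ≡ countPaths k (move s right) t ℕ.+ countPaths k (move s up) t
  countPaths-suc k s t below =
    trans (count-++ (goodPath s t) (map (right ∷_) (stepSeqs k)) (map (up ∷_) (stepSeqs k)))
          (cong₂ ℕ._+_ (count-map _ _ _ (firstStep right) (stepSeqs k)) (count-map _ _ _ (firstStep up) (stepSeqs k)))
    where
    firstStep : ∀ d ds → goodPath s t (d ∷ ds) ≡ goodPath (move s d) t ds
    firstStep d ds = trans (goodPath-∷ s t d ds) (cong (_∧ goodPath (move s d) t ds) below)

  countPaths-aboveDiag : ∀ k s t → belowDiag s ≡ false → countPaths k s t ≡ 0
  countPaths-aboveDiag k s t above = count-none (goodPath s t) rejected (stepSeqs k)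
    where
    rejected : ∀ ds → goodPath s t ds ≡ false
    rejected []       = trans (cong (λ b → samePoint s t ∧ (b ∧ true)) above) (∧-zeroʳ (samePoint s t))
    rejected (d ∷ ds) = trans (goodPath-∷ s t d ds) (cong (_∧ goodPath (move s d) t ds) above)

  ≤ᵇ-refl : ∀ i → (i ≤ᵇ i) ≡ true
  ≤ᵇ-refl i = to T-≡ (ℤ.≤⇒≤ᵇ (ℤ.≤-refl {i}))

  eqℤ-sound : ∀ {i j} → T (eqℤ i j) → i ≡ j
  eqℤ-sound t with to T-∧ t
  ... | i≤j , j≤i = ℤ.≤-antisym (ℤ.≤ᵇ⇒≤ i≤j) (ℤ.≤ᵇ⇒≤ j≤i)

  samePoint-sound : ∀ s t → T (samePoint s t) → s ≡ t
  samePoint-sound (a , b) (c , d) same with to T-∧ same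
  ... | a≈c , b≈d = cong₂ _,_ (eqℤ-sound a≈c) (eqℤ-sound b≈d)

  countPaths-zero-refl : ∀ x → countPaths 0 (x , x) (x , x) ≡ 1
  countPaths-zero-refl x rewrite ≤ᵇ-refl x = refl

  countPaths-zero-≢ : ∀ s t → s ≢ t → countPaths 0 s t ≡ 0
  countPaths-zero-≢ s t s≢t with goodPath s t [] in good
  ... | false = refl
  ... | true  = ⊥-elim (s≢t (samePoint-sound s t (proj₁ (to T-∧ (from T-≡ good)))))

  i≢i+[1+n] : ∀ i n → i ≢ i + + suc n
  i≢i+[1+n] i n i≡i+[1+n] with ∙-cancelˡ i (+ 0) (+ suc n) (trans (ℤ.+-identityʳ i) i≡i+[1+n])
  ... | ()

  i+i≡j+j⇒i≡j : ∀ {i j} → i + i ≡ j + j → i ≡ j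
  i+i≡j+j⇒i≡j {i} {j} i+i≡j+j = ℤ.*-cancelˡ-≡ (+ 2) i j (trans (twice i) (trans i+i≡j+j (sym (twice j))))
    where
    twice : ∀ i → + 2 * i ≡ i + i
    twice = solve-∀

  height⇒belowDiag : ∀ p q h → p ≡ q + + h → belowDiag (p , q) ≡ true
  height⇒belowDiag _ q h refl = to T-≡ (ℤ.≤⇒≤ᵇ (ℤ.i≤i+j q (+ h)))

  diag⇒up-aboveDiag : ∀ p q → p ≡ q + + 0 → belowDiag (p , q + + 1) ≡ false
  diag⇒up-aboveDiag _ q refl = ¬-not λ below → i≢i+[1+n] q 0
    (ℤ.≤-antisym (ℤ.i≤i+j q (+ 1)) (ℤ.≤-trans (ℤ.≤ᵇ⇒≤ (from T-≡ below)) (ℤ.≤-reflexive (ℤ.+-identityʳ q))))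

  right-height : ∀ p q h → p ≡ q + + h → p + + 1 ≡ q + + suc h
  right-height _ q h refl = shift q (+ h)
    where
    shift : ∀ q h → q + h + + 1 ≡ q + (+ 1 + h)
    shift = solve-∀

  up-height : ∀ p q h → p ≡ q + + suc h → p ≡ q + + 1 + + h
  up-height _ q h p≡q+1+h = trans p≡q+1+h (sym (ℤ.+-assoc q (+ 1) (+ h)))

  right-balanced : ∀ k p q x → + suc k + (p + q) ≡ x + x → + k + (p + + 1 + q) ≡ x + x
  right-balanced k p q _ = trans (shift (+ k) p q)
    where
    shift : ∀ k p q → k + (p + + 1 + q) ≡ + 1 + k + (p + q)
    shift = solve-∀

  up-balanced : ∀ k p q x → + suc k + (p + q) ≡ x + x → + k + (p + (q + + 1)) ≡ x + x
  up-balanced k p q _ = trans (shift (+ k) p q)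
    where
    shift : ∀ k p q → k + (p + (q + + 1)) ≡ + 1 + k + (p + q)
    shift = solve-∀

  -- The balance hypothesis holds for every k-step path from (p , q) to (x , x): each step raises p + q by one.
  countPaths≡walks : ∀ k h p q x → p ≡ q + + h → + k + (p + q) ≡ x + x →
                     countPaths k (p , q) (x , x) ≡ walks h k
  countPaths≡walks zero zero p q x p≡q+0 balanced =
    trans (cong₂ (λ a b → countPaths 0 (a , b) (x , x)) p≡x q≡x) (countPaths-zero-refl x)
    where
    p≡q : p ≡ q
    p≡q = trans p≡q+0 (ℤ.+-identityʳ q)
    p≡x : p ≡ x
    p≡x = i+i≡j+j⇒i≡j (trans (cong (λ i → p + i) p≡q) (trans (sym (ℤ.+-identityˡ (p + q))) balanced))
    q≡x : q ≡ x
    q≡x = trans (sym p≡q) p≡x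
  countPaths≡walks zero (suc h) p q x p≡q+h _ =
    countPaths-zero-≢ (p , q) (x , x) λ { refl → i≢i+[1+n] x h p≡q+h }
  countPaths≡walks (suc k) zero p q x p≡q+0 balanced = begin
    countPaths (suc k) (p , q) (x , x)
      ≡⟨ countPaths-suc k (p , q) (x , x) (height⇒belowDiag p q 0 p≡q+0) ⟩
    countPaths k (p + + 1 , q) (x , x) ℕ.+ countPaths k (p , q + + 1) (x , x)
      ≡⟨ cong₂ ℕ._+_ rightward (countPaths-aboveDiag k (p , q + + 1) (x , x) (diag⇒up-aboveDiag p q p≡q+0)) ⟩
    walks 1 k ℕ.+ 0
      ≡⟨ ℕ.+-identityʳ (walks 1 k) ⟩
    walks 0 (suc k) ∎
    where
    open ≡-Reasoning
    rightward : countPaths k (p + + 1 , q) (x , x) ≡ walks 1 k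
    rightward = countPaths≡walks k 1 (p + + 1) q x (right-height p q 0 p≡q+0) (right-balanced k p q x balanced)
  countPaths≡walks (suc k) (suc h) p q x p≡q+h balanced =
    trans (countPaths-suc k (p , q) (x , x) (height⇒belowDiag p q (suc h) p≡q+h)) (cong₂ ℕ._+_ rightward upward)
    where
    rightward : countPaths k (p + + 1 , q) (x , x) ≡ walks (suc (suc h)) k
    rightward = countPaths≡walks k (suc (suc h)) (p + + 1) q x (right-height p q (suc h) p≡q+h) (right-balanced k p q x balanced)
    upward : countPaths k (p , q + + 1) (x , x) ≡ walks h k
    upward = countPaths≡walks k h p (q + + 1) x (up-height p q h p≡q+h) (up-balanced k p q x balanced)

  𝒞≡walks : ∀ n m → 𝒞 n m ≡ walks (double m) (double n)
  𝒞≡walks n m = begin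
    𝒞 n m
      ≡⟨ countPaths≡walks (2 ℕ.* n) (2 ℕ.* m) (+ 0) (- + (2 ℕ.* m)) (+ n - + m) start balanced ⟩
    walks (2 ℕ.* m) (2 ℕ.* n)
      ≡⟨ cong₂ walks (2*≡double m) (2*≡double n) ⟩
    walks (double m) (double n) ∎
    where
    open ≡-Reasoning
    start : + 0 ≡ - + (2 ℕ.* m) + + (2 ℕ.* m)
    start = sym (ℤ.+-inverseˡ (+ (2 ℕ.* m)))
    balanced : + (2 ℕ.* n) + (+ 0 + - + (2 ℕ.* m)) ≡ (+ n - + m) + (+ n - + m)
    balanced = trans (cong₂ (λ a b → a + (+ 0 + - b)) (ℤ.pos-* 2 n) (ℤ.pos-* 2 m)) (expand (+ n) (+ m))
      where
      expand : ∀ n m → + 2 * n + (+ 0 + - (+ 2 * m)) ≡ (n - m) + (n - m)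
      expand = solve-∀

open import Data.Nat using (ℕ; suc; _+_; _*_)
open import Data.Nat.Properties using (+-comm)
open import Function using (_∘_)
open import Relation.Binary.PropositionalEquality
open Convolution using (double; _⋆_; ⋆-cong; sumTriples-⋆)
open Walks using (walks; dyck; walks-decomposition)
open LatticePaths using (𝒞≡walks)

lemma6p2 : (m n : ℕ) →
    𝒞 (n + m + 1) (m + 1) ≡ sumTriples n (λ a b c → 𝒞 (a + m) m * 𝒞 b 0 * 𝒞 c 0)
lemma6p2 m n = begin
  𝒞 (n + m + 1) (m + 1)
    ≡⟨ cong₂ 𝒞 (trans (+-comm (n + m) 1) (cong suc (+-comm n m))) (+-comm m 1) ⟩
  𝒞 (suc (m + n)) (suc m)
    ≡⟨ 𝒞≡walks (suc (m + n)) (suc m) ⟩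
  walks (2 + double m) (2 + double (m + n))
    ≡⟨ walks-decomposition m n ⟩
  ((λ a → walks (double m) (double (m + a))) ⋆ (dyck ∘ double ⋆ dyck ∘ double)) n
    ≡⟨ ⋆-cong 𝒞-shifted (⋆-cong (λ b → 𝒞≡walks b 0) (λ c → 𝒞≡walks c 0)) n ⟨
  ((λ a → 𝒞 (a + m) m) ⋆ ((λ b → 𝒞 b 0) ⋆ (λ c → 𝒞 c 0))) n
    ≡⟨ sumTriples-⋆ n _ _ _ ⟨
  sumTriples n (λ a b c → 𝒞 (a + m) m * 𝒞 b 0 * 𝒞 c 0) ∎
  where
  open ≡-Reasoning
  𝒞-shifted : ∀ a → 𝒞 (a + m) m ≡ walks (double m) (double (m + a))
  𝒞-shifted a = trans (𝒞≡walks (a + m) m) (cong (walks (double m) ∘ double) (+-comm a m))
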